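{- Let $\mathcal T\in\Sigma^n$ be a text, let $\alpha$ be a right-maximal substring of $\mathcal T$ with suffix tree locus $u$, and let $[b,e]$ be the range of indices $k$ such that $\mathcal T[1,\mathtt{st\text{ - }lex}[k]]$ has suffix $\alpha$. Then the set of first letters of the labels of the outgoing edges of $u$ equals $\{c: c\in\mathcal L[b,e],\ c\neq\#\}$.
   Context: A text is a string $\mathcal T\in\Sigma^n$ (1-indexed) whose last symbol $\$$ occurs only at position $n$ and is smaller than all other symbols; $\mathcal T[1,0]$ is empty. A substring $\alpha$ is right-maximal if it is a suffix of $\mathcal T$ or $\alpha a,\alpha b$ both occur for distinct letters $a,b$; its locus is the suffix tree node with path label $\alpha$. $\mathrm{ISA}[i]$ is the lexicographic rank of $\mathcal T[i,n]$; $\mathrm{rlce}(i,j)$ is the length of the longest common prefix of $\mathcal T[i,n],\mathcal T[j,n]$. For a permutation $\pi$ of $[n]$: $\mathrm{LPF}_\pi[i]=0$ if $\pi(i)=1$, else $\max_{j:\pi(j)<\pi(i)}\mathrm{rlce}(j,i)$; $\mathrm{PDA}_\pi=\{i+\mathrm{LPF}_\pi[i]:i\in[n]\}$. Let $\mathtt{st\text{ - }lex}^-=\mathrm{PDA}_\pi$ for $\pi=\mathrm{ISA}$, $\mathtt{st\text{ - }lex}^+=\mathrm{PDA}_{\bar\pi}$ for $\bar\pi(i)=n-\mathrm{ISA}[i]+1$, and $\mathtt{st\text{ - }lex}$ the array containing $\{i-1: i\in\mathtt{st\text{ - }lex}^-\cup\mathtt{st\text{ - }lex}^+\cup\{n+1\}\}$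 sorted increasingly by colexicographic order of the prefixes $\mathcal T[1,j]$. With a new symbol $\#\notin\Sigma$, the string $\mathcal L[1,|\mathtt{st\text{ - }lex}|]$ is defined by $\mathcal L[k]=\#$ if $\mathtt{st\text{ - }lex}[k]=n$ and $\mathcal L[k]=\mathcal T[\mathtt{st\text{ - }lex}[k]+1]$ otherwise. -}

module Defs where

open import Data.Nat using (ℕ; zero; suc; _+_; _∸_; _≤_; _<_; _<ᵇ_; _≡ᵇ_; _⊔_)
open import Data.Nat.Properties using (_≟_)
open import Data.Bool using (Bool; true; false; if_then_else_; _∧_)
open import Data.List using (List; []; _∷_; _++_; [_]; length; drop; take; map; filter; reverse; deduplicate; foldr; upTo; sum)
open import Data.Maybe using (Maybe; just; nothing)
open import Data.Product using (Σ; _×_; ∃; ∃-syntax; _,_)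
open import Data.Sum using (_⊎_)
open import Relation.Binary.PropositionalEquality using (_≡_; _≢_)

-- Alphabet: symbols are natural numbers with their usual order.
-- A text is a list of symbols; positions are 1-indexed.

at : {A : Set} → List A → ℕ → Maybe A
at xs       zero          = nothing
at []       (suc i)       = nothing
at (x ∷ xs) (suc zero)    = just x
at (x ∷ xs) (suc (suc i)) = at xs (suc i)

-- T is a text: nonempty, and its last symbol $ (at position n) is
-- strictly smaller than every other symbol of T (hence occurs only at n).
IsText : List ℕ → Set
IsText T = Σ ℕ λ d → Σ (List ℕ) λ R → (T ≡ R ++ [ d ]) ×
  (∀ i x → at R i ≡ just x → d < x)

range1 : ℕ → List ℕ
range1 n = map suc (upTo n)

suf : List ℕ → ℕ → List ℕ
suf T i = drop (i ∸ 1) T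

pre : List ℕ → ℕ → List ℕ
pre T j = take j T

lexLess : List ℕ → List ℕ → Bool
lexLess []       []       = false
lexLess []       (_ ∷ _)  = true
lexLess (_ ∷ _)  []       = false
lexLess (x ∷ xs) (y ∷ ys) =
  if x <ᵇ y then true else (if y <ᵇ x then false else lexLess xs ys)

lcp : List ℕ → List ℕ → ℕ
lcp (x ∷ xs) (y ∷ ys) = if x ≡ᵇ y then suc (lcp xs ys) else 0
lcp _ _ = 0

count : {A : Set} → (A → Bool) → List A → ℕ
count p xs = length (filter (λ x → p x Data.Bool.≟ true) xs)
  where import Data.Bool

ISA : List ℕ → ℕ → ℕ
ISA T i = suc (count (λ j → lexLess (suf T j) (suf T i)) (range1 (length T)))

rlce : List ℕ → ℕ → ℕ → ℕ
rlce T i j = lcp (suf T i) (suf T j)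

maxList : List ℕ → ℕ
maxList = foldr _⊔_ 0

LPF : List ℕ → (ℕ → ℕ) → ℕ → ℕ
LPF T π i =
  if π i ≡ᵇ 1 then 0
  else maxList (map (λ j → rlce T j i)
                    (filter (λ j → (π j <ᵇ π i) Data.Bool.≟ true) (range1 (length T))))
  where import Data.Bool

PDA : List ℕ → (ℕ → ℕ) → List ℕ
PDA T π = map (λ i → i + LPF T π i) (range1 (length T))

ISAbar : List ℕ → ℕ → ℕ
ISAbar T i = suc (length T ∸ ISA T i)

st-lex⁻ st-lex⁺ : List ℕ → List ℕ
st-lex⁻ T = PDA T (ISA T)
st-lex⁺ T = PDA T (ISAbar T)

st-lexSet : List ℕ → List ℕ
st-lexSet T = deduplicate _≟_
  (map (λ i → i ∸ 1) (st-lex⁻ T ++ st-lex⁺ T ++ [ suc (length T) ]))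

colexLess : List ℕ → ℕ → ℕ → Bool
colexLess T j j' = lexLess (reverse (pre T j)) (reverse (pre T j'))

insert : {A : Set} → (A → A → Bool) → A → List A → List A
insert lt x [] = x ∷ []
insert lt x (y ∷ ys) = if lt x y then x ∷ y ∷ ys else y ∷ insert lt x ys

insertionSort : {A : Set} → (A → A → Bool) → List A → List A
insertionSort lt = foldr (insert lt) []

-- the array st-lex (1-indexed via `at`)
st-lex : List ℕ → List ℕ
st-lex T = insertionSort (colexLess T) (st-lexSet T)

data Sym : Set where
  # : Sym
  chr : ℕ → Sym

Lsym : List ℕ → ℕ → Sym
Lsym T j with j ≡ᵇ length T | at T (suc j)
... | true  | _        = #
... | false | just c   = chr c
... | false | nothing  = #   -- unreachable for j < n

L : List ℕ → List Sym
L T = map (Lsym T) (st-lex T)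

Occurs : List ℕ → List ℕ → Set
Occurs α T = ∃[ u ] ∃[ v ] (T ≡ u ++ α ++ v)

HasSuffix : List ℕ → List ℕ → Set
HasSuffix s α = ∃[ u ] (s ≡ u ++ α)

RightMaximal : List ℕ → List ℕ → Set
RightMaximal T α = HasSuffix T α ⊎
  (∃[ a ] ∃[ b ] (a ≢ b × Occurs (α ++ [ a ]) T × Occurs (α ++ [ b ]) T))

-- c is the first letter of the label of an outgoing edge of the suffix
-- tree node whose path label is α (the locus of α): the edges leaving the
-- locus of α are in bijection with the letters c such that αc occurs in T.
OutEdgeFirstLetter : List ℕ → List ℕ → ℕ → Set
OutEdgeFirstLetter T α c = Occurs (α ++ [ c ]) T

-- Right to left: an entry k ∈ [b, e] with L[k] = c is a prefix T[1, j] ending in α with T[j + 1] = c,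
-- so αc occurs.  Left to right: among the suffixes starting with αc take the first one, i, in the order
-- π = ISA (lexicographically smallest) or π = n - ISA + 1 (largest).  A suffix of smaller π-rank sharing
-- more than |α| letters with it would also start with αc, so LPF_π[i] ≤ |α|.  Right-maximality gives a
-- second extension αd, d ≠ c (if α is a suffix of T it ends in $, which no letter follows); for d < c
-- in the first order, for d > c in the second, its suffix has smaller rank and shares α with suffix i,
-- so LPF_π[i] = |α|.  Then i + |α| ∈ PDA_π, and j = i - 1 + |α| is an st-lex entry with T[1, j] ending in
-- α and T[j + 1] = c.  For α empty the bound LPF_ISA[i] ≤ 0 already suffices.
module Submission where

open import Defs
open import Data.Bool using (Bool; true; false) renaming (T to IsTrue)
import Data.Bool as Bool
open import Data.Bool.Properties using (T-≡)
open import Data.Empty using (⊥-elim)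
open import Data.List using (List; []; _∷_; _++_; [_]; length; drop; take; map; filter; upTo; initLast; _∷ʳ′_)
open import Data.List.Properties
  using (++-assoc; ∷-injective; ∷-injectiveʳ; ∷ʳ-injectiveʳ; drop-drop; take++drop≡id; length-++; length-map;
         length-upTo; filter-notAll; ≡-dec)
open import Data.List.Membership.Propositional using (_∈_; lose)
open import Data.List.Membership.Propositional.Properties
  using (∈-map⁺; ∈-map⁻; ∈-filter⁺; ∈-filter⁻; ∈-upTo⁺; ∈-++⁺ˡ; ∈-++⁺ʳ; ∈-deduplicate⁺)
open import Data.List.Relation.Unary.Any using (here; there)
import Data.List.Relation.Unary.All as All
open import Data.List.Relation.Binary.Lex.Core using (halt; this; next)
open import Data.List.Relation.Binary.Lex.Strict using (Lex-<; <-transitive; <-irreflexive)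
import Data.List.Relation.Binary.Pointwise as Pointwise
open import Data.List.Extrema.Nat using (argmin; argmin-all; f[argmin]≤f[xs])
open import Data.Maybe as Maybe using (just)
open import Data.Maybe.Properties using (just-injective)
open import Data.Nat using (ℕ; zero; suc; _+_; _∸_; _≤_; _<_; _<ᵇ_; _≡ᵇ_; z≤n; s≤s; s≤s⁻¹)
open import Data.Nat.Properties
open import Data.Product using (_×_; ∃-syntax; _,_; proj₁; proj₂)
open import Data.Sum as Sum using (_⊎_; inj₁; inj₂)
open import Function using (_∘_; _⇔_; mk⇔; Equivalence)
open import Relation.Binary using (tri<; tri≈; tri>)
open import Relation.Binary.PropositionalEquality
  using (_≡_; _≢_; refl; sym; trans; cong; cong₂; subst; isEquivalence; module ≡-Reasoning)
open import Relation.Nullary using (¬_; yes; no; contradiction)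
open import Relation.Nullary.Reflects using (ofʸ; ofⁿ)
open import Relation.Unary using (Decidable)

private variable
  A B : Set

at-map : (f : A → B) (xs : List A) (k : ℕ) → at (map f xs) k ≡ Maybe.map f (at xs k)
at-map f xs       zero          = refl
at-map f []       (suc k)       = refl
at-map f (x ∷ xs) (suc zero)    = refl
at-map f (x ∷ xs) (suc (suc k)) = at-map f xs (suc k)

∈⇒at : {x : A} {xs : List A} → x ∈ xs → ∃[ k ] (1 ≤ k × k ≤ length xs × at xs k ≡ just x)
∈⇒at (here refl) = 1 , s≤s z≤n , s≤s z≤n , refl
∈⇒at (there x∈xs) with ∈⇒at x∈xs
... | suc k , _ , k≤len , atk = suc (suc k) , s≤s z≤n , s≤s k≤len , atk

at⇒< : (xs : List A) (j : ℕ) {x : A} → at xs (suc j) ≡ just x → j < length xs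
at⇒< (_ ∷ xs) zero    _   = s≤s z≤n
at⇒< (_ ∷ xs) (suc j) atx = s≤s (at⇒< xs j atx)

at⇒drop : (xs : List A) (j : ℕ) {x : A} → at xs (suc j) ≡ just x → drop j xs ≡ x ∷ drop (suc j) xs
at⇒drop (_ ∷ xs) zero    refl = refl
at⇒drop (_ ∷ xs) (suc j) atx  = at⇒drop xs j atx

drop⇒at : (xs : List A) (j : ℕ) {x : A} {ys : List A} → drop j xs ≡ x ∷ ys → at xs (suc j) ≡ just x
drop⇒at (_ ∷ xs) zero    refl = refl
drop⇒at (_ ∷ xs) (suc j) eq   = drop⇒at xs j eq

drop-length-++ : (xs ys : List A) → drop (length xs) (xs ++ ys) ≡ ys
drop-length-++ []       ys = refl
drop-length-++ (x ∷ xs) ys = drop-length-++ xs ys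

take-length-++ : (xs ys : List A) → take (length xs) (xs ++ ys) ≡ xs
take-length-++ []       ys = refl
take-length-++ (x ∷ xs) ys = cong (x ∷_) (take-length-++ xs ys)

take-+ : (q : ℕ) (xs ys zs : List A) → drop q xs ≡ ys ++ zs → take (q + length ys) xs ≡ take q xs ++ ys
take-+ zero    xs       ys zs refl = take-length-++ ys zs
take-+ (suc q) []       [] zs _    = refl
take-+ (suc q) (x ∷ xs) ys zs eq   = cong (x ∷_) (take-+ q xs ys zs eq)

at-+ : (q : ℕ) (xs ys : List A) {x : A} {zs : List A} →
  drop q xs ≡ ys ++ x ∷ zs → at xs (suc (q + length ys)) ≡ just x
at-+ q xs ys {x} {zs} eq = drop⇒at xs (q + length ys) (begin
  drop (q + length ys) xs         ≡⟨ drop-drop q (length ys) xs ⟨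
  drop (length ys) (drop q xs)    ≡⟨ cong (drop (length ys)) eq ⟩
  drop (length ys) (ys ++ x ∷ zs) ≡⟨ drop-length-++ ys (x ∷ zs) ⟩
  x ∷ zs                          ∎)
  where open ≡-Reasoning

∈-insert⁺ˡ : (lt : A → A → Bool) (x : A) (ys : List A) → x ∈ insert lt x ys
∈-insert⁺ˡ lt x []       = here refl
∈-insert⁺ˡ lt x (y ∷ ys) with lt x y
... | true  = here refl
... | false = there (∈-insert⁺ˡ lt x ys)

∈-insert⁺ʳ : (lt : A → A → Bool) (x : A) {z : A} (ys : List A) → z ∈ ys → z ∈ insert lt x ys
∈-insert⁺ʳ lt x (y ∷ ys) z∈ys with lt x y | z∈ys
... | true  | _          = there z∈ys
... | false | here refl  = here refl
... | false | there z∈ys = there (∈-insert⁺ʳ lt x ys z∈ys)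

∈-insertionSort⁺ : (lt : A → A → Bool) {z : A} (xs : List A) → z ∈ xs → z ∈ insertionSort lt xs
∈-insertionSort⁺ lt (x ∷ xs) (here refl)  = ∈-insert⁺ˡ lt x (insertionSort lt xs)
∈-insertionSort⁺ lt (x ∷ xs) (there z∈xs) =
  ∈-insert⁺ʳ lt x (insertionSort lt xs) (∈-insertionSort⁺ lt xs z∈xs)

count-mono : (p q : ℕ → Bool) (xs : List ℕ) → (∀ {x} → x ∈ xs → IsTrue (p x) → IsTrue (q x)) →
  count p xs ≤ count q xs
count-mono p q []       _   = z≤n
count-mono p q (x ∷ xs) p⇒q with p x | q x | p⇒q (here refl)
... | true  | true  | _     = s≤s (count-mono p q xs (p⇒q ∘ there))
... | true  | false | px⇒qx = ⊥-elim (px⇒qx _)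
... | false | true  | _     = m≤n⇒m≤1+n (count-mono p q xs (p⇒q ∘ there))
... | false | false | _     = count-mono p q xs (p⇒q ∘ there)

count-strictMono : (p q : ℕ → Bool) (xs : List ℕ) → (∀ {x} → x ∈ xs → IsTrue (p x) → IsTrue (q x)) →
  ∀ {y} → y ∈ xs → ¬ IsTrue (p y) → IsTrue (q y) → count p xs < count q xs
count-strictMono p q (x ∷ xs) p⇒q (here refl) ¬py qy with p x | q x
... | false | true = s≤s (count-mono p q xs (p⇒q ∘ there))
... | true  | _    = ⊥-elim (¬py _)
count-strictMono p q (x ∷ xs) p⇒q (there y∈xs) ¬py qy with p x | q x | p⇒q (here refl)
... | true  | true  | _     = s≤s (count-strictMono p q xs (p⇒q ∘ there) y∈xs ¬py qy)
... | true  | false | px⇒qx = ⊥-elim (px⇒qx _)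
... | false | true  | _     = m≤n⇒m≤1+n (count-strictMono p q xs (p⇒q ∘ there) y∈xs ¬py qy)
... | false | false | _     = count-strictMono p q xs (p⇒q ∘ there) y∈xs ¬py qy

_<ₗₑₓ_ : List ℕ → List ℕ → Set
_<ₗₑₓ_ = Lex-< _≡_ _<_

lexLess⇒<ₗₑₓ : (xs ys : List ℕ) → IsTrue (lexLess xs ys) → xs <ₗₑₓ ys
lexLess⇒<ₗₑₓ []       (y ∷ ys) _ = halt
lexLess⇒<ₗₑₓ (x ∷ xs) (y ∷ ys) lt with x <ᵇ y | <ᵇ-reflects-< x y
... | true  | ofʸ x<y = this x<y
... | false | ofⁿ x≮y with y <ᵇ x | <ᵇ-reflects-< y x
...   | false | ofⁿ y≮x = next (≤-antisym (≮⇒≥ y≮x) (≮⇒≥ x≮y)) (lexLess⇒<ₗₑₓ xs ys lt)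

<ₗₑₓ⇒lexLess : {xs ys : List ℕ} → xs <ₗₑₓ ys → IsTrue (lexLess xs ys)
<ₗₑₓ⇒lexLess halt = _
<ₗₑₓ⇒lexLess (this {x} {_} {y} x<y) with x <ᵇ y | <ᵇ-reflects-< x y
... | true  | _       = _
... | false | ofⁿ x≮y = contradiction x<y x≮y
<ₗₑₓ⇒lexLess (next {x} refl xs<ys) with x <ᵇ x | <ᵇ-reflects-< x x
... | true  | ofʸ x<x = contradiction x<x (<-irrefl refl)
... | false | _       = <ₗₑₓ⇒lexLess xs<ys

lexLess-irrefl : (xs : List ℕ) → ¬ IsTrue (lexLess xs xs)
lexLess-irrefl xs xs<xs =
  <-irreflexive (λ { refl → <-irrefl refl }) (Pointwise.refl refl) (lexLess⇒<ₗₑₓ xs xs xs<xs)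

lexLess-trans : (xs ys zs : List ℕ) → IsTrue (lexLess xs ys) → IsTrue (lexLess ys zs) → IsTrue (lexLess xs zs)
lexLess-trans xs ys zs xs<ys ys<zs = <ₗₑₓ⇒lexLess
  (<-transitive isEquivalence <-resp₂-≡ <-trans (lexLess⇒<ₗₑₓ xs ys xs<ys) (lexLess⇒<ₗₑₓ ys zs ys<zs))

<ₗₑₓ-++ : (α : List ℕ) {d c : ℕ} {v w : List ℕ} → d < c → (α ++ d ∷ v) <ₗₑₓ (α ++ c ∷ w)
<ₗₑₓ-++ []      d<c = this d<c
<ₗₑₓ-++ (a ∷ α) d<c = next refl (<ₗₑₓ-++ α d<c)

lcp-++ : (α xs ys : List ℕ) → length α ≤ lcp (α ++ xs) (α ++ ys)
lcp-++ []      xs ys = z≤n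
lcp-++ (a ∷ α) xs ys with a ≡ᵇ a | ≡⇒≡ᵇ a a refl
... | true | _ = s≤s (lcp-++ α xs ys)

lcp⇒take≡ : (m : ℕ) (xs ys : List ℕ) → m ≤ lcp xs ys → take m xs ≡ take m ys
lcp⇒take≡ zero    xs       ys       _     = refl
lcp⇒take≡ (suc m) (x ∷ xs) (y ∷ ys) m<lcp with x ≡ᵇ y | ≡ᵇ⇒≡ x y
... | true | x≡y = cong₂ _∷_ (x≡y _) (lcp⇒take≡ m xs ys (s≤s⁻¹ m<lcp))

positions : List ℕ → List ℕ
positions T = range1 (length T)

suc∈positions : (T : List ℕ) {p : ℕ} → p < length T → suc p ∈ positions T
suc∈positions T p<n = ∈-map⁺ suc (∈-upTo⁺ p<n)

∈positions⇒suc : (T : List ℕ) {q : ℕ} → q ∈ positions T → ∃[ q₀ ] (q ≡ suc q₀)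
∈positions⇒suc T q∈ with ∈-map⁻ suc q∈
... | q₀ , _ , q≡ = q₀ , q≡

length-positions : (T : List ℕ) → length (positions T) ≡ length T
length-positions T = trans (length-map suc (upTo (length T))) (length-upTo (length T))

ISA-mono : (T : List ℕ) {p i : ℕ} → p ∈ positions T → IsTrue (lexLess (suf T p) (suf T i)) → ISA T p < ISA T i
ISA-mono T {p} {i} p∈ p<i = s≤s (count-strictMono _ _ (positions T)
  (λ {j} _ j<p → lexLess-trans (suf T j) (suf T p) (suf T i) j<p p<i) p∈ (lexLess-irrefl (suf T p)) p<i)

ISA≤length : (T : List ℕ) {p : ℕ} → p ∈ positions T → ISA T p ≤ length T
ISA≤length T {p} p∈ = subst (ISA T p ≤_) (length-positions T)
  (filter-notAll (λ j → lexLess (suf T j) (suf T p) Bool.≟ true) (positions T)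
    (lose p∈ (lexLess-irrefl (suf T p) ∘ Equivalence.from T-≡)))

ISAbar-antimono : (T : List ℕ) {p i : ℕ} → i ∈ positions T → p ∈ positions T →
  IsTrue (lexLess (suf T i) (suf T p)) → ISAbar T p < ISAbar T i
ISAbar-antimono T {p} {i} i∈ p∈ i<p = s≤s (∸-monoʳ-< (ISA-mono T {i} {p} i∈ i<p) (ISA≤length T p∈))

maxList-upper : {x : ℕ} (xs : List ℕ) → x ∈ xs → x ≤ maxList xs
maxList-upper (y ∷ ys) (here refl)  = m≤m⊔n y (maxList ys)
maxList-upper (y ∷ ys) (there x∈ys) = ≤-trans (maxList-upper ys x∈ys) (m≤n⊔m y (maxList ys))

maxList-least : {m : ℕ} (xs : List ℕ) → (∀ {x} → x ∈ xs → x ≤ m) → maxList xs ≤ m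
maxList-least []       _    = z≤n
maxList-least (y ∷ ys) ys≤m = ⊔-lub (ys≤m (here refl)) (maxList-least ys (ys≤m ∘ there))

module _ (T : List ℕ) (π : ℕ → ℕ) where

  private
    earlier : ℕ → List ℕ
    earlier i = filter (λ j → (π j <ᵇ π i) Bool.≟ true) (positions T)

  LPF≤ : (i m : ℕ) → (∀ {j} → j ∈ positions T → π j < π i → rlce T j i ≤ m) → LPF T π i ≤ m
  LPF≤ i m bound with π i ≡ᵇ 1
  ... | true  = z≤n
  ... | false = maxList-least (map (λ j → rlce T j i) (earlier i)) λ x∈ →
    let j , j∈ , x≡ = ∈-map⁻ (λ j → rlce T j i) x∈
        j∈T , πj<πi = ∈-filter⁻ (λ j → (π j <ᵇ π i) Bool.≟ true) j∈
    in subst (_≤ m) (sym x≡) (bound j∈T (<ᵇ⇒< (π j) (π i) (Equivalence.from T-≡ πj<πi)))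

  -- 0 < π j < π i rules out π i ≡ 1, where LPF is 0 by definition.
  ≤LPF : {i j m : ℕ} → j ∈ positions T → 0 < π j → π j < π i → m ≤ rlce T j i → m ≤ LPF T π i
  ≤LPF {i} {j} j∈ 0<πj πj<πi m≤rlce with π i ≡ᵇ 1 | ≡ᵇ⇒≡ (π i) 1
  ... | true  | πi≡1 = contradiction (subst (π j <_) (πi≡1 _) πj<πi) (<⇒≱ 0<πj ∘ s≤s⁻¹)
  ... | false | _    = ≤-trans m≤rlce
    (maxList-upper (map (λ j → rlce T j i) (earlier i)) (∈-map⁺ (λ j → rlce T j i) j∈earlier))
    where
    j∈earlier : j ∈ earlier i
    j∈earlier = ∈-filter⁺ (λ j → (π j <ᵇ π i) Bool.≟ true) j∈ (Equivalence.to T-≡ (<⇒<ᵇ πj<πi))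

LPF-phraseEnd : (T : List ℕ) (π : ℕ → ℕ) {i m : ℕ} → i ∈ positions T → LPF T π i ≡ m → i + m ∈ PDA T π
LPF-phraseEnd T π i∈ refl = ∈-map⁺ (λ i → i + LPF T π i) i∈

PDA⊆st-lex : (T : List ℕ) {x : ℕ} → x ∈ st-lex⁻ T ⊎ x ∈ st-lex⁺ T → x ∸ 1 ∈ st-lex T
PDA⊆st-lex T x∈ =
  ∈-insertionSort⁺ (colexLess T) (st-lexSet T) (∈-deduplicate⁺ _≟_ (∈-map⁺ (_∸ 1) (∈-PDAs x∈)))
  where
  ∈-PDAs : {x : ℕ} → x ∈ st-lex⁻ T ⊎ x ∈ st-lex⁺ T → x ∈ st-lex⁻ T ++ st-lex⁺ T ++ [ suc (length T) ]
  ∈-PDAs (inj₁ x∈⁻) = ∈-++⁺ˡ x∈⁻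
  ∈-PDAs (inj₂ x∈⁺) = ∈-++⁺ʳ (st-lex⁻ T) (∈-++⁺ˡ x∈⁺)

StartsWith : List ℕ → List ℕ → Set
StartsWith xs s = take (length s) xs ≡ s

startsWith⇒++ : (xs s : List ℕ) → StartsWith xs s → xs ≡ s ++ drop (length s) xs
startsWith⇒++ xs s sw = trans (sym (take++drop≡id (length s) xs)) (cong (_++ drop (length s) xs) sw)

startsWith-snoc : (xs α : List ℕ) {c : ℕ} → StartsWith xs (α ++ [ c ]) → ∃[ w ] (xs ≡ α ++ c ∷ w)
startsWith-snoc xs α {c} sw = _ , trans (startsWith⇒++ xs (α ++ [ c ]) sw) (++-assoc α [ c ] _)

length-snoc : (α : List ℕ) {c : ℕ} → length (α ++ [ c ]) ≡ suc (length α)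
length-snoc α = trans (length-++ α) (+-comm (length α) 1)

OccursAt : List ℕ → List ℕ → ℕ → Set
OccursAt T s q = q ∈ positions T × StartsWith (suf T q) s

module FirstOccurrence (T s : List ℕ) (π : ℕ → ℕ) where

  private
    startsWith? : Decidable (λ q → StartsWith (suf T q) s)
    startsWith? q = ≡-dec _≟_ (take (length s) (suf T q)) s

    occurrences : List ℕ
    occurrences = filter startsWith? (positions T)

  -- p is the default of argmin, so first p is an occurrence whenever p is.
  first : ℕ → ℕ
  first p = argmin π p occurrences

  first-occurs : {p : ℕ} → OccursAt T s p → OccursAt T s (first p)
  first-occurs occ = argmin-all π occ (All.tabulate (∈-filter⁻ startsWith?))

  first-minimal : (p : ℕ) {q : ℕ} → OccursAt T s q → π (first p) ≤ π q
  first-minimal p (q∈ , sw) = All.lookup (f[argmin]≤f[xs] p occurrences) (∈-filter⁺ startsWith? q∈ sw)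

  LPF-first≤ : {p m : ℕ} → length s ≡ suc m → OccursAt T s p → LPF T π (first p) ≤ m
  LPF-first≤ {p} {m} |s|≡ occ = LPF≤ T π (first p) m λ {j} j∈ πj<πi → ≮⇒≥ λ m<rlce →
    <⇒≱ πj<πi (first-minimal p (j∈ , j-startsWith j m<rlce))
    where
    j-startsWith : (j : ℕ) → m < rlce T j (first p) → StartsWith (suf T j) s
    j-startsWith j m<rlce = trans
      (lcp⇒take≡ (length s) (suf T j) (suf T (first p)) (subst (_≤ rlce T j (first p)) (sym |s|≡) m<rlce))
      (proj₂ (first-occurs occ))

occurs⇒occursAt : (T α : List ℕ) {c : ℕ} → Occurs (α ++ [ c ]) T → ∃[ p ] OccursAt T (α ++ [ c ]) p
occurs⇒occursAt T α {c} (u , v , T≡) =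
  suc (length u) , suc∈positions T |u|<n ,
  subst (λ xs → StartsWith xs (α ++ [ c ])) (sym drop≡) (take-length-++ (α ++ [ c ]) v)
  where
  drop≡ : drop (length u) T ≡ (α ++ [ c ]) ++ v
  drop≡ = trans (cong (drop (length u)) T≡) (drop-length-++ u _)
  |u|<n : length u < length T
  |u|<n = m+n≤o⇒m≤o (suc (length u)) (at⇒< T _ (at-+ (length u) T α (trans drop≡ (++-assoc α [ c ] v))))

occursAt-lexLess : (T α : List ℕ) {c d q i : ℕ} → d < c →
  OccursAt T (α ++ [ d ]) q → OccursAt T (α ++ [ c ]) i → IsTrue (lexLess (suf T q) (suf T i))
occursAt-lexLess T α {q = q} {i} d<c (_ , q-sw) (_ , i-sw)
  with startsWith-snoc (suf T q) α q-sw | startsWith-snoc (suf T i) α i-sw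
... | _ , sq | _ , si rewrite sq | si = <ₗₑₓ⇒lexLess (<ₗₑₓ-++ α d<c)

occursAt-rlce : (T α : List ℕ) {c d q i : ℕ} →
  OccursAt T (α ++ [ d ]) q → OccursAt T (α ++ [ c ]) i → length α ≤ rlce T q i
occursAt-rlce T α {q = q} {i} (_ , q-sw) (_ , i-sw)
  with startsWith-snoc (suf T q) α q-sw | startsWith-snoc (suf T i) α i-sw
... | _ , sq | _ , si rewrite sq | si = lcp-++ α _ _

∈-init : (R w : List ℕ) {d x y : ℕ} {v : List ℕ} → R ++ [ d ] ≡ w ++ x ∷ y ∷ v → x ∈ R
∈-init (r ∷ R) []      eq = here (sym (proj₁ (∷-injective eq)))
∈-init (r ∷ R) (_ ∷ w) eq = there (∈-init R w (∷-injectiveʳ eq))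
∈-init []      []          ()
∈-init []      (_ ∷ [])    ()
∈-init []      (_ ∷ _ ∷ _) ()

suffix-not-extendable : (T : List ℕ) → IsText T → (α : List ℕ) → HasSuffix T α → α ≢ [] →
  (c : ℕ) → ¬ Occurs (α ++ [ c ]) T
suffix-not-extendable T text α suffix α≢[] c occ with initLast α
... | [] = α≢[] refl
... | α₀ ∷ʳ′ x with text | suffix | occ
...   | d , R , T≡ , d<R | u , T≡u++α | u' , v , T≡occ = <-irrefl (sym x≡d) d<x
  where
  open ≡-Reasoning
  x≡d : x ≡ d
  x≡d = ∷ʳ-injectiveʳ (u ++ α₀) R (trans (++-assoc u α₀ [ x ]) (trans (sym T≡u++α) T≡))
  x∈R : x ∈ R
  x∈R = ∈-init R (u' ++ α₀) (begin
    R ++ [ d ]                          ≡⟨ T≡ ⟨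
    T                                   ≡⟨ T≡occ ⟩
    u' ++ ((α₀ ++ [ x ]) ++ [ c ]) ++ v ≡⟨ cong (u' ++_) (++-assoc (α₀ ++ [ x ]) [ c ] v) ⟩
    u' ++ (α₀ ++ [ x ]) ++ c ∷ v        ≡⟨ cong (u' ++_) (++-assoc α₀ [ x ] (c ∷ v)) ⟩
    u' ++ α₀ ++ x ∷ c ∷ v               ≡⟨ ++-assoc u' α₀ (x ∷ c ∷ v) ⟨
    (u' ++ α₀) ++ x ∷ c ∷ v             ∎)
  d<x : d < x
  d<x with ∈⇒at x∈R
  ... | k , _ , _ , atk = d<R k x atk

rightMaximal⇒otherExtension : (T : List ℕ) → IsText T → (α : List ℕ) → RightMaximal T α → α ≢ [] →
  (c : ℕ) → Occurs (α ++ [ c ]) T → ∃[ d ] (d ≢ c × Occurs (α ++ [ d ]) T)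
rightMaximal⇒otherExtension T text α (inj₁ suffix) α≢[] c occ =
  contradiction occ (suffix-not-extendable T text α suffix α≢[] c)
rightMaximal⇒otherExtension T text α (inj₂ (a , b , a≢b , occ-a , occ-b)) α≢[] c _ with a ≟ c
... | yes refl = b , a≢b ∘ sym , occ-b
... | no a≢c   = a , a≢c , occ-a

-- Such an i makes i + |α| a phrase end in PDA_ISA or PDA_ISAbar (LPF-phraseEnd).
Boundary : List ℕ → List ℕ → ℕ → ℕ → Set
Boundary T α c i = OccursAt T (α ++ [ c ]) i × (LPF T (ISA T) i ≡ length α ⊎ LPF T (ISAbar T) i ≡ length α)

module _ (T α : List ℕ) {c p : ℕ} (p-occ : OccursAt T (α ++ [ c ]) p) where

  module _ (π : ℕ → ℕ) where
    open FirstOccurrence T (α ++ [ c ]) π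

    LPF-first≡ : {q : ℕ} → q ∈ positions T → 0 < π q → π q < π (first p) → length α ≤ rlce T q (first p) →
      LPF T π (first p) ≡ length α
    LPF-first≡ q∈ 0<πq πq<πi α≤rlce =
      ≤-antisym (LPF-first≤ (length-snoc α) p-occ) (≤LPF T π q∈ 0<πq πq<πi α≤rlce)

  boundary-below : {d q : ℕ} → d < c → OccursAt T (α ++ [ d ]) q → ∃[ i ] Boundary T α c i
  boundary-below {q = q} d<c q-occ@(q∈ , _) = first p , i-occ , inj₁ (LPF-first≡ (ISA T) q∈ (s≤s z≤n)
    (ISA-mono T {q} {first p} q∈ (occursAt-lexLess T α d<c q-occ i-occ)) (occursAt-rlce T α q-occ i-occ))
    where
    open FirstOccurrence T (α ++ [ c ]) (ISA T)
    i-occ : OccursAt T (α ++ [ c ]) (first p)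
    i-occ = first-occurs p-occ

  boundary-above : {d q : ℕ} → c < d → OccursAt T (α ++ [ d ]) q → ∃[ i ] Boundary T α c i
  boundary-above {q = q} c<d q-occ@(q∈ , _) = first p , i-occ , inj₂ (LPF-first≡ (ISAbar T) q∈ (s≤s z≤n)
    (ISAbar-antimono T {q} {first p} (proj₁ i-occ) q∈ (occursAt-lexLess T α c<d i-occ q-occ))
    (occursAt-rlce T α q-occ i-occ))
    where
    open FirstOccurrence T (α ++ [ c ]) (ISAbar T)
    i-occ : OccursAt T (α ++ [ c ]) (first p)
    i-occ = first-occurs p-occ

boundary-exists : (T : List ℕ) → IsText T → (α : List ℕ) → RightMaximal T α → (c : ℕ) →
  Occurs (α ++ [ c ]) T → ∃[ i ] Boundary T α c i
boundary-exists T text α rm c occ with occurs⇒occursAt T α occ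
boundary-exists T text [] rm c occ | p , p-occ =
  first p , first-occurs p-occ , inj₁ (n≤0⇒n≡0 (LPF-first≤ refl p-occ))
  where open FirstOccurrence T [ c ] (ISA T)
boundary-exists T text α@(_ ∷ _) rm c occ | p , p-occ
  with rightMaximal⇒otherExtension T text α rm (λ ()) c occ
... | d , d≢c , occ-d with occurs⇒occursAt T α occ-d | <-cmp d c
...   | q , q-occ | tri< d<c _ _ = boundary-below T α p-occ d<c q-occ
...   | _ , _     | tri≈ _ d≡c _ = contradiction d≡c d≢c
...   | q , q-occ | tri> _ _ c<d = boundary-above T α p-occ c<d q-occ

boundary⇒st-lex : (T α : List ℕ) {c i : ℕ} → Boundary T α c i →
  ∃[ j ] (j ∈ st-lex T × HasSuffix (pre T j) α × at T (suc j) ≡ just c)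
boundary⇒st-lex T α {c} {i} ((i∈ , i-sw) , LPF≡) with ∈positions⇒suc T i∈ | startsWith-snoc (suf T i) α i-sw
... | q₀ , refl | w , si =
  q₀ + length α ,
  PDA⊆st-lex T (Sum.map (LPF-phraseEnd T (ISA T) i∈) (LPF-phraseEnd T (ISAbar T) i∈) LPF≡) ,
  (take q₀ T , take-+ q₀ T α (c ∷ w) si) ,
  at-+ q₀ T α si

prefix-next⇒occurs : (T α : List ℕ) {j c : ℕ} → HasSuffix (pre T j) α → at T (suc j) ≡ just c →
  Occurs (α ++ [ c ]) T
prefix-next⇒occurs T α {j} {c} (u , pre≡) atj = u , drop (suc j) T , (begin
  T                                   ≡⟨ take++drop≡id j T ⟨
  take j T ++ drop j T                ≡⟨ cong₂ _++_ pre≡ (at⇒drop T j atj) ⟩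
  (u ++ α) ++ c ∷ drop (suc j) T      ≡⟨ ++-assoc u α _ ⟩
  u ++ α ++ c ∷ drop (suc j) T        ≡⟨ cong (u ++_) (++-assoc α [ c ] _) ⟨
  u ++ (α ++ [ c ]) ++ drop (suc j) T ∎)
  where open ≡-Reasoning

Lsym≡chr⇔ : (T : List ℕ) {j c : ℕ} → Lsym T j ≡ chr c ⇔ at T (suc j) ≡ just c
Lsym≡chr⇔ T {j} {c} = mk⇔ to from
  where
  to : Lsym T j ≡ chr c → at T (suc j) ≡ just c
  to eq with j ≡ᵇ length T | at T (suc j)
  to refl | false | just _ = refl
  from : at T (suc j) ≡ just c → Lsym T j ≡ chr c
  from atj with j ≡ᵇ length T | ≡ᵇ⇒≡ j (length T)
  ... | true  | j≡n = contradiction (j≡n _) (<⇒≢ (at⇒< T j atj))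
  ... | false | _ rewrite atj = refl

at-L : (T : List ℕ) (k : ℕ) {j : ℕ} → at (st-lex T) k ≡ just j → at (L T) k ≡ just (Lsym T j)
at-L T k atk = trans (at-map (Lsym T) (st-lex T) k) (cong (Maybe.map (Lsym T)) atk)

corollary25 : (T : List ℕ) → IsText T → (α : List ℕ) → RightMaximal T α →
    (b e : ℕ) → 1 ≤ b → e ≤ length (st-lex T) →
    (∀ k → 1 ≤ k → k ≤ length (st-lex T) →
      ((b ≤ k × k ≤ e) ⇔ (∃[ j ] (at (st-lex T) k ≡ just j × HasSuffix (pre T j) α)))) →
    ∀ c → OutEdgeFirstLetter T α c ⇔ (∃[ k ] (b ≤ k × k ≤ e × at (L T) k ≡ just (chr c)))
corollary25 T text α rm b e 1≤b e≤|st-lex| range c = mk⇔ to from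
  where
  to : OutEdgeFirstLetter T α c → ∃[ k ] (b ≤ k × k ≤ e × at (L T) k ≡ just (chr c))
  to occ with boundary-exists T text α rm c occ
  ... | _ , boundary with boundary⇒st-lex T α boundary
  ... | j , j∈ , α⊑ , atj with ∈⇒at j∈
  ... | k , 1≤k , k≤ , atk with Equivalence.from (range k 1≤k k≤) (j , atk , α⊑)
  ... | b≤k , k≤e = k , b≤k , k≤e , trans (at-L T k atk) (cong just (Equivalence.from (Lsym≡chr⇔ T) atj))

  from : ∃[ k ] (b ≤ k × k ≤ e × at (L T) k ≡ just (chr c)) → OutEdgeFirstLetter T α c
  from (k , b≤k , k≤e , atL) with Equivalence.to (range k (≤-trans 1≤b b≤k) (≤-trans k≤e e≤|st-lex|)) (b≤k , k≤e)
  ... | j , atk , α⊑ =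
    prefix-next⇒occurs T α α⊑ (Equivalence.to (Lsym≡chr⇔ T) (just-injective (trans (sym (at-L T k atk)) atL)))
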